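{- Let $G=(V,E)$ be a 3-edge-connected cubic graph and let $\mathcal{C}$ be a cycle cover of $G$. Let $x\in\mathbb{R}^E$ be given by $x_e=\frac12$ for $e\in\mathcal{C}$ and $x_e=1$ for $e\notin\mathcal{C}$. Then $x\in\mathrm{LP}(G)$.
   Context: A cycle cover of $G$ is a set of vertex-disjoint cycles of $G$ covering all vertices (identified with its edge set). $\mathrm{LP}(G)$ is the set of $x\in\mathbb{R}^E$ with $x(\delta(S))\ge2$ for all $\emptyset\subset S\subset V$ and $0\le x\le2$. -}

module Defs where

open import Data.Nat as ℕ using (ℕ; zero; suc; _<?_)
open import Data.Fin as Fin using (Fin; toℕ; fromℕ<)
open import Data.Bool using (Bool; true; false; _xor_; _∨_; if_then_else_)
open import Data.Product using (Σ; ∃; ∃-syntax; _×_; _,_; proj₁; proj₂)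
open import Data.Sum using (_⊎_)
open import Data.Vec using (Vec; lookup)
open import Data.Rational using (ℚ; 0ℚ; ½; 1ℚ; _+_; _≤_)
open import Relation.Nullary using (¬_; yes; no)
open import Relation.Nullary.Decidable using (⌊_⌋)
open import Relation.Binary.PropositionalEquality using (_≡_; _≢_)

record Graph : Set where
  field
    n        : ℕ
    m        : ℕ
    ends     : Fin m → Fin n × Fin n
    loopless : ∀ e → proj₁ (ends e) ≢ proj₂ (ends e)
open Graph public

Joins : (G : Graph) → Fin (m G) → Fin (n G) → Fin (n G) → Set
Joins G e a b =
  (proj₁ (ends G e) ≡ a × proj₂ (ends G e) ≡ b) ⊎
  (proj₁ (ends G e) ≡ b × proj₂ (ends G e) ≡ a)

sumℕ : ∀ {k} → (Fin k → ℕ) → ℕ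
sumℕ {zero}  f = 0
sumℕ {suc k} f = f Fin.zero ℕ.+ sumℕ (λ i → f (Fin.suc i))

sumℚ : ∀ {k} → (Fin k → ℚ) → ℚ
sumℚ {zero}  f = 0ℚ
sumℚ {suc k} f = f Fin.zero + sumℚ (λ i → f (Fin.suc i))

incident : (G : Graph) → Fin (n G) → Fin (m G) → Bool
incident G v e = ⌊ proj₁ (ends G e) Fin.≟ v ⌋ ∨ ⌊ proj₂ (ends G e) Fin.≟ v ⌋

degree : (G : Graph) → Fin (n G) → ℕ
degree G v = sumℕ (λ e → if incident G v e then 1 else 0)

Cubic : Graph → Set
Cubic G = ∀ v → degree G v ≡ 3

-- vertex subsets as boolean vectors (Data.Fin.Subset convention: true = member)
-- edge e lies in the cut δ(S) iff exactly one endpoint is in S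
inCut : (G : Graph) → Vec Bool (n G) → Fin (m G) → Bool
inCut G S e = lookup S (proj₁ (ends G e)) xor lookup S (proj₂ (ends G e))

NonTrivial : ∀ {k} → Vec Bool k → Set
NonTrivial S = (∃[ v ] lookup S v ≡ true) × (∃[ v ] lookup S v ≡ false)

cutSize : (G : Graph) → Vec Bool (n G) → ℕ
cutSize G S = sumℕ (λ e → if inCut G S e then 1 else 0)

-- k-edge-connected: every cut δ(S), ∅ ⊂ S ⊂ V, has at least k edges
-- (equivalently, deleting fewer than k edges leaves G connected)
EdgeConnected : ℕ → Graph → Set
EdgeConnected k G = ∀ (S : Vec Bool (n G)) → NonTrivial S → k ℕ.≤ cutSize G S

-- a cycle of length k ≥ 2 (length 2 = two parallel edges):
-- distinct vertices vs 0..k-1, distinct edges es i joining vs i and vs (i+1 mod k)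
record Cycle (G : Graph) : Set where
  field
    len    : ℕ
    len≥2  : 2 ℕ.≤ len
    vs     : Fin len → Fin (n G)
    es     : Fin len → Fin (m G)
    vs-inj : ∀ i j → vs i ≡ vs j → i ≡ j
    es-inj : ∀ i j → es i ≡ es j → i ≡ j
    joins  : ∀ (i : Fin len) → Σ (Fin len) λ i' →
               toℕ i' ≡ (if ⌊ suc (toℕ i) <? len ⌋ then suc (toℕ i) else 0) ×
               Joins G (es i) (vs i) (vs i')
open Cycle public

record CycleCover (G : Graph) : Set where
  field
    count    : ℕ
    cyc      : Fin count → Cycle G
    disjoint : ∀ p q i j → vs (cyc p) i ≡ vs (cyc q) j → p ≡ q
    covers   : ∀ v → ∃[ p ] ∃[ i ] vs (cyc p) i ≡ v
open CycleCover public

_∈E_ : ∀ {G} → Fin (m G) → CycleCover G → Set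
e ∈E C = ∃[ p ] ∃[ i ] es (cyc C p) i ≡ e

InLP : (G : Graph) → (Fin (m G) → ℚ) → Set
InLP G x =
  (∀ (S : Vec Bool (n G)) → NonTrivial S →
     (1ℚ + 1ℚ) ≤ sumℚ (λ e → if inCut G S e then x e else 0ℚ)) ×
  (∀ e → 0ℚ ≤ x e) × (∀ e → x e ≤ 1ℚ + 1ℚ)

module Submission where

-- Fix a cut δ(S), ∅ ⊂ S ⊂ V, and let a (resp. b) be the number of
-- cycle-cover (resp. other) edges in δ(S).  Then 2·x(δ(S)) = a + 2b.
--   * Walking once around a cycle, the side of S changes at every edge of
--     the cycle lying in δ(S) and returns to where it started, so every
--     cycle meets δ(S) in an even number of edges (`cyclic-crossings-even`).
--     The cycles of a cover are edge-disjoint, so a is the sum of these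
--     even numbers (`cover-crossings`) and hence even.
--   * 3-edge-connectivity gives a + b ≥ 3; with a even this forces
--     a + 2b ≥ 4 (`even-cut-bound`), i.e. x(δ(S)) ≥ 2.
-- The bounds 0 ≤ x ≤ 2 are immediate since x only takes the values ½, 1.

open import Defs
open import Data.Fin using (Fin)
open import Data.Rational using (ℚ; ½; 1ℚ)
open import Relation.Nullary using (¬_)
open import Relation.Binary.PropositionalEquality using (_≡_)

open import Data.Nat as ℕ using (ℕ; zero; suc; _+_; _*_; _≤_; z≤n; s≤s; _<_; _<?_)
import Data.Nat.Properties as ℕₚ
open import Data.Fin as Fin using (toℕ; inject₁; fromℕ; _≟_)
import Data.Fin.Properties as Finₚ
open import Data.Bool using (Bool; true; false; not; _∧_; _xor_; if_then_else_)
open import Data.Bool.Properties using (xor-comm)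
open import Data.Parity using (Parity; 0ℙ; 1ℙ) renaming (_+_ to _+ℙ_)
open import Data.Parity.Properties using (p+p≡0ℙ; ⁻¹-involutive; +-homo-+)
open import Data.Product using (∃; _×_; _,_; proj₁; proj₂)
open import Data.Sum using (inj₁; inj₂)
open import Data.Vec using (Vec; lookup)
import Data.Rational as ℚ
import Data.Rational.Properties as ℚₚ
open import Relation.Nullary using (Dec; yes; no; does; contradiction)
open import Relation.Nullary.Decidable using (⌊_⌋; from-yes)
open import Relation.Unary using (Pred; Decidable)
open import Relation.Binary.PropositionalEquality using (refl; sym; trans; cong; cong₂; module ≡-Reasoning)
open import Algebra.Properties.CommutativeMonoid.Sum ℕₚ.+-0-commutativeMonoid
  using (sum; sum-cong-≗; sum-replicate-zero; sum-init-last; ∑-distrib-+; ∑-comm)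
open import Algebra.Properties.Semiring.Sum ℕₚ.+-*-semiring using (*-distribˡ-sum)
open import Algebra.Properties.Monoid.Mult ℚₚ.+-0-monoid
  using (×-homo-+) renaming (_×_ to _×ℚ_)

open ≡-Reasoning

ind : Bool → ℕ
ind b = if b then 1 else 0

-- `sumℕ` of Defs is the library's monoid sum, so the library lemmas apply.
sumℕ≡sum : ∀ {k} (f : Fin k → ℕ) → sumℕ f ≡ sum f
sumℕ≡sum {zero}  f = refl
sumℕ≡sum {suc k} f = cong (f Fin.zero +_) (sumℕ≡sum (λ i → f (Fin.suc i)))

sum-zeros : ∀ {k} (f : Fin k → ℕ) → (∀ i → f i ≡ 0) → sum f ≡ 0
sum-zeros {k} f f≡0 = trans (sum-cong-≗ f≡0) (sum-replicate-zero k)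

count-unique : ∀ {k p} {P : Pred (Fin k) p} (P? : Decidable P) →
               (∀ {i j} → P i → P j → i ≡ j) →
               sum (λ i → ind (does (P? i))) ≡ ind (does (Finₚ.any? P?))
count-unique {zero}  P? unique = refl
count-unique {suc k} P? unique with P? Fin.zero
... | yes P0 = cong suc (sum-zeros _ no-other)
  where
  no-other : ∀ i → ind (does (P? (Fin.suc i))) ≡ 0
  no-other i with P? (Fin.suc i)
  ... | yes Pi = contradiction (unique P0 Pi) Finₚ.0≢1+n
  ... | no _   = refl
... | no _   = count-unique (λ i → P? (Fin.suc i))
                            (λ Pi Pj → Finₚ.suc-injective (unique Pi Pj))

sum-point : ∀ {k} (a : Fin k) (g : Fin k → ℕ) →
            sum (λ e → g e * ind (does (a ≟ e))) ≡ g a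
sum-point {suc k} Fin.zero g = begin
  g Fin.zero * 1 + sum (λ e → g (Fin.suc e) * 0)
    ≡⟨ cong₂ _+_ (ℕₚ.*-identityʳ (g Fin.zero))
                 (sum-zeros _ (λ e → ℕₚ.*-zeroʳ (g (Fin.suc e)))) ⟩
  g Fin.zero + 0
    ≡⟨ ℕₚ.+-identityʳ (g Fin.zero) ⟩
  g Fin.zero ∎
sum-point {suc k} (Fin.suc a) g =
  cong₂ _+_ (ℕₚ.*-zeroʳ (g Fin.zero)) (sum-point a (λ e → g (Fin.suc e)))

side : Bool → Parity
side false = 0ℙ
side true  = 1ℙ

crossing-parity : ∀ a b → ℕ.parity (ind (a xor b)) ≡ side a +ℙ side b
crossing-parity false false = refl
crossing-parity false true  = refl
crossing-parity true  false = refl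
crossing-parity true  true  = refl

telescope-step : ∀ p q r → (p +ℙ q) +ℙ (q +ℙ r) ≡ p +ℙ r
telescope-step 0ℙ 0ℙ r = refl
telescope-step 0ℙ 1ℙ r = ⁻¹-involutive r
telescope-step 1ℙ 0ℙ r = refl
telescope-step 1ℙ 1ℙ r = refl

telescope : ∀ K (b : Fin (suc K) → Bool) →
            ℕ.parity (sum (λ j → ind (b (inject₁ j) xor b (Fin.suc j))))
              ≡ side (b Fin.zero) +ℙ side (b (fromℕ K))
telescope zero b = sym (p+p≡0ℙ (side (b Fin.zero)))
telescope (suc K) b = begin
  ℕ.parity (ind (b₀ xor b₁) + sum (λ j → ind (b (Fin.suc (inject₁ j)) xor b (Fin.suc (Fin.suc j)))))
    ≡⟨ +-homo-+ (ind (b₀ xor b₁)) _ ⟩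
  ℕ.parity (ind (b₀ xor b₁)) +ℙ ℕ.parity (sum (λ j → ind (b (Fin.suc (inject₁ j)) xor b (Fin.suc (Fin.suc j)))))
    ≡⟨ cong₂ _+ℙ_ (crossing-parity b₀ b₁) (telescope K (λ i → b (Fin.suc i))) ⟩
  (side b₀ +ℙ side b₁) +ℙ (side b₁ +ℙ side (b (fromℕ (suc K))))
    ≡⟨ telescope-step (side b₀) (side b₁) _ ⟩
  side b₀ +ℙ side (b (fromℕ (suc K))) ∎
  where
  b₀ b₁ : Bool
  b₀ = b Fin.zero
  b₁ = b (Fin.suc Fin.zero)

cyclicStep : ℕ → ℕ → ℕ
cyclicStep L k = if ⌊ suc k <? L ⌋ then suc k else 0

CyclicSuccessor : ∀ {L} → (Fin L → Fin L) → Set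
CyclicSuccessor {L} next = ∀ i → toℕ (next i) ≡ cyclicStep L (toℕ i)

cyclicStep-inner : ∀ {k L} → suc k < L → cyclicStep L k ≡ suc k
cyclicStep-inner {k} {L} k+1<L with suc k <? L
... | yes _       = refl
... | no  k+1≮L   = contradiction k+1<L k+1≮L

cyclicStep-last : ∀ K → cyclicStep (suc K) K ≡ 0
cyclicStep-last K with suc K <? suc K
... | yes K<K = contradiction K<K (ℕₚ.<-irrefl refl)
... | no  _   = refl

successor-inner : ∀ {K} {next : Fin (suc K) → Fin (suc K)} →
                  CyclicSuccessor next → ∀ j → next (inject₁ j) ≡ Fin.suc j
successor-inner {K} {next} is-next j = Finₚ.toℕ-injective (begin
  toℕ (next (inject₁ j))               ≡⟨ is-next (inject₁ j) ⟩
  cyclicStep (suc K) (toℕ (inject₁ j)) ≡⟨ cong (cyclicStep (suc K)) (Finₚ.toℕ-inject₁ j) ⟩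
  cyclicStep (suc K) (toℕ j)           ≡⟨ cyclicStep-inner (s≤s (Finₚ.toℕ<n j)) ⟩
  suc (toℕ j)                          ∎)

successor-last : ∀ {K} {next : Fin (suc K) → Fin (suc K)} →
                 CyclicSuccessor next → next (fromℕ K) ≡ Fin.zero
successor-last {K} {next} is-next = Finₚ.toℕ-injective (begin
  toℕ (next (fromℕ K))               ≡⟨ is-next (fromℕ K) ⟩
  cyclicStep (suc K) (toℕ (fromℕ K)) ≡⟨ cong (cyclicStep (suc K)) (Finₚ.toℕ-fromℕ K) ⟩
  cyclicStep (suc K) K               ≡⟨ cyclicStep-last K ⟩
  0                                  ∎)

-- Going once around a cycle, the side changes an even number of times:
-- the path part telescopes and the closing step undoes it.
cyclic-crossings-even : ∀ {L} (b : Fin L → Bool) {next : Fin L → Fin L} →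
                        CyclicSuccessor next →
                        ℕ.parity (sum (λ i → ind (b i xor b (next i)))) ≡ 0ℙ
cyclic-crossings-even {zero}  b _ = refl
cyclic-crossings-even {suc K} b {next} is-next = begin
  ℕ.parity (sum crossing)
    ≡⟨ cong ℕ.parity (sum-init-last crossing) ⟩
  ℕ.parity (sum (λ j → crossing (inject₁ j)) + crossing (fromℕ K))
    ≡⟨ +-homo-+ (sum (λ j → crossing (inject₁ j))) _ ⟩
  ℕ.parity (sum (λ j → crossing (inject₁ j))) +ℙ ℕ.parity (crossing (fromℕ K))
    ≡⟨ cong₂ _+ℙ_ path-part closing-part ⟩
  (side b₀ +ℙ side bₖ) +ℙ (side bₖ +ℙ side b₀)
    ≡⟨ telescope-step (side b₀) (side bₖ) (side b₀) ⟩
  side b₀ +ℙ side b₀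
    ≡⟨ p+p≡0ℙ (side b₀) ⟩
  0ℙ ∎
  where
  crossing : Fin (suc K) → ℕ
  crossing i = ind (b i xor b (next i))
  b₀ bₖ : Bool
  b₀ = b Fin.zero
  bₖ = b (fromℕ K)
  path-part : ℕ.parity (sum (λ j → crossing (inject₁ j))) ≡ side b₀ +ℙ side bₖ
  path-part = trans
    (cong ℕ.parity (sum-cong-≗ (λ j →
      cong (λ v → ind (b (inject₁ j) xor b v)) (successor-inner is-next j))))
    (telescope K b)
  closing-part : ℕ.parity (crossing (fromℕ K)) ≡ side bₖ +ℙ side b₀
  closing-part = trans (cong (λ v → ℕ.parity (ind (bₖ xor b v))) (successor-last is-next))
                       (crossing-parity bₖ b₀)

sum-even : ∀ {k} (f : Fin k → ℕ) → (∀ i → ℕ.parity (f i) ≡ 0ℙ) →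
           ℕ.parity (sum f) ≡ 0ℙ
sum-even {zero}  f even = refl
sum-even {suc k} f even = begin
  ℕ.parity (f Fin.zero + sum (λ i → f (Fin.suc i)))
    ≡⟨ +-homo-+ (f Fin.zero) _ ⟩
  ℕ.parity (f Fin.zero) +ℙ ℕ.parity (sum (λ i → f (Fin.suc i)))
    ≡⟨ cong₂ _+ℙ_ (even Fin.zero) (sum-even (λ i → f (Fin.suc i)) (λ i → even (Fin.suc i))) ⟩
  0ℙ ∎

ind-∧ : ∀ a b → ind (a ∧ b) ≡ ind a * ind b
ind-∧ false b     = refl
ind-∧ true  false = refl
ind-∧ true  true  = refl

ind-split : ∀ a b → ind a ≡ ind (a ∧ b) + ind (a ∧ not b)
ind-split false b     = refl
ind-split true  false = refl
ind-split true  true  = refl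

-- Twice the value x_e of an edge: 1 on cover edges, 2 on the others.
doubleValue : Bool → ℕ
doubleValue inCover = if inCover then 1 else 2

doubleValue-split : ∀ a b → (if a then doubleValue b else 0) ≡
                    ind (a ∧ b) + (ind (a ∧ not b) + ind (a ∧ not b))
doubleValue-split false b     = refl
doubleValue-split true  false = refl
doubleValue-split true  true  = refl

-- A cut with at least 3 edges, an even number a of them in the cover,
-- has doubled value a + 2b ≥ 4: if b = 0 then a ≥ 3 is even.
even-cut-bound : ∀ a b → 3 ≤ a + b → ℕ.parity a ≡ 0ℙ → 4 ≤ a + (b + b)
even-cut-bound a (suc b) 3≤a+b _ =
  ℕₚ.≤-trans (ℕₚ.+-mono-≤ 3≤a+b (s≤s (z≤n {b})))
             (ℕₚ.≤-reflexive (ℕₚ.+-assoc a (suc b) (suc b)))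
even-cut-bound (suc (suc (suc (suc a)))) zero _ _ = s≤s (s≤s (s≤s (s≤s z≤n)))
even-cut-bound (suc (suc (suc zero))) zero _ ()
even-cut-bound (suc (suc zero)) zero (s≤s (s≤s ())) _
even-cut-bound (suc zero)       zero (s≤s ()) _
even-cut-bound zero             zero () _

module _ (G : Graph) where

  cut-joining : ∀ (S : Vec Bool (n G)) {e a b} → Joins G e a b →
                inCut G S e ≡ lookup S a xor lookup S b
  cut-joining S (inj₁ (refl , refl)) = refl
  cut-joining S {e} (inj₂ (refl , refl)) =
    xor-comm (lookup S (proj₁ (ends G e))) (lookup S (proj₂ (ends G e)))

  cycle-crossings-even : (S : Vec Bool (n G)) (Γ : Cycle G) →
                         ℕ.parity (sum (λ i → ind (inCut G S (es Γ i)))) ≡ 0ℙ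
  cycle-crossings-even S Γ = trans
    (cong ℕ.parity (sum-cong-≗ (λ i → cong ind (cut-joining S (proj₂ (proj₂ (joins Γ i)))))))
    (cyclic-crossings-even (λ i → lookup S (vs Γ i))
                           {λ i → proj₁ (joins Γ i)} (λ i → proj₁ (proj₂ (joins Γ i))))

  endpoint-on-cycle : (Γ : Cycle G) (i : Fin (len Γ)) →
                      ∃ λ j → proj₁ (ends G (es Γ i)) ≡ vs Γ j
  endpoint-on-cycle Γ i with joins Γ i
  ... | _  , _ , inj₁ (first≡ , _) = i  , first≡
  ... | i′ , _ , inj₂ (first≡ , _) = i′ , first≡

module _ {G : Graph} (C : CycleCover G) where

  inCover? : (e : Fin (m G)) → Dec (e ∈E C)
  inCover? e = Finₚ.any? λ p → Finₚ.any? λ i → es (cyc C p) i ≟ e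

  -- The cycles of a cover are edge-disjoint, since they are vertex-disjoint.
  cover-edge-disjoint : ∀ {p q i j} → es (cyc C p) i ≡ es (cyc C q) j → p ≡ q
  cover-edge-disjoint {p} {q} {i} {j} same with endpoint-on-cycle G (cyc C p) i
                                             | endpoint-on-cycle G (cyc C q) j
  ... | (i′ , on-p) | (j′ , on-q) =
    disjoint C p q i′ j′ (trans (sym on-p) (trans (cong (λ e → proj₁ (ends G e)) same) on-q))

  -- Each edge occurs at most once among all positions of all cycles, so the
  -- number of its occurrences is the indicator of cover membership.
  cover-occurrences : ∀ e →
    sum (λ p → sum (λ i → ind (does (es (cyc C p) i ≟ e)))) ≡ ind (does (inCover? e))
  cover-occurrences e = begin
    sum (λ p → sum (λ i → ind (does (es (cyc C p) i ≟ e))))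
      ≡⟨ sum-cong-≗ (λ p → count-unique (λ i → es (cyc C p) i ≟ e)
                      (λ at-i at-j → es-inj (cyc C p) _ _ (trans at-i (sym at-j)))) ⟩
    sum (λ p → ind (does (Finₚ.any? λ i → es (cyc C p) i ≟ e)))
      ≡⟨ count-unique (λ p → Finₚ.any? λ i → es (cyc C p) i ≟ e)
           (λ { (_ , at-i) (_ , at-j) → cover-edge-disjoint (trans at-i (sym at-j)) }) ⟩
    ind (does (inCover? e)) ∎

  module _ (S : Vec Bool (n G)) where

    coverCut : ℕ
    coverCut = sum (λ e → ind (inCut G S e ∧ does (inCover? e)))

    otherCut : ℕ
    otherCut = sum (λ e → ind (inCut G S e ∧ not (does (inCover? e))))

    cover-crossings :
      coverCut ≡ sum (λ p → sum (λ i → ind (inCut G S (es (cyc C p) i))))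
    cover-crossings = begin
      sum (λ e → ind (c e ∧ does (inCover? e)))
        ≡⟨ sum-cong-≗ (λ e → ind-∧ (c e) _) ⟩
      sum (λ e → ind (c e) * ind (does (inCover? e)))
        ≡⟨ sum-cong-≗ (λ e → cong (ind (c e) *_) (sym (cover-occurrences e))) ⟩
      sum (λ e → ind (c e) * sum (λ p → sum (λ i → δ p i e)))
        ≡⟨ sum-cong-≗ distribute ⟩
      sum (λ e → sum (λ p → sum (λ i → ind (c e) * δ p i e)))
        ≡⟨ ∑-comm (λ e p → sum (λ i → ind (c e) * δ p i e)) ⟩
      sum (λ p → sum (λ e → sum (λ i → ind (c e) * δ p i e)))
        ≡⟨ sum-cong-≗ (λ p → ∑-comm (λ e i → ind (c e) * δ p i e)) ⟩
      sum (λ p → sum (λ i → sum (λ e → ind (c e) * δ p i e)))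
        ≡⟨ sum-cong-≗ (λ p → sum-cong-≗ (λ i → sum-point (es (cyc C p) i) (λ e → ind (c e)))) ⟩
      sum (λ p → sum (λ i → ind (c (es (cyc C p) i)))) ∎
      where
      c : Fin (m G) → Bool
      c = inCut G S
      δ : ∀ p → Fin (len (cyc C p)) → Fin (m G) → ℕ
      δ p i e = ind (does (es (cyc C p) i ≟ e))
      distribute : ∀ e → ind (c e) * sum (λ p → sum (λ i → δ p i e)) ≡
                         sum (λ p → sum (λ i → ind (c e) * δ p i e))
      distribute e = trans (*-distribˡ-sum (ind (c e)) (λ p → sum (λ i → δ p i e)))
                           (sum-cong-≗ (λ p → *-distribˡ-sum (ind (c e)) (λ i → δ p i e)))

    coverCut-even : ℕ.parity coverCut ≡ 0ℙ
    coverCut-even = trans (cong ℕ.parity cover-crossings)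
                          (sum-even _ (λ p → cycle-crossings-even G S (cyc C p)))

    cutSize-split : cutSize G S ≡ coverCut + otherCut
    cutSize-split = begin
      sumℕ (λ e → ind (inCut G S e))
        ≡⟨ sumℕ≡sum (λ e → ind (inCut G S e)) ⟩
      sum (λ e → ind (inCut G S e))
        ≡⟨ sum-cong-≗ (λ e → ind-split (inCut G S e) (does (inCover? e))) ⟩
      sum (λ e → ind (inCut G S e ∧ does (inCover? e)) + ind (inCut G S e ∧ not (does (inCover? e))))
        ≡⟨ ∑-distrib-+ (λ e → ind (inCut G S e ∧ does (inCover? e)))
                       (λ e → ind (inCut G S e ∧ not (does (inCover? e)))) ⟩
      coverCut + otherCut ∎

    -- Twice the LP value x(δ(S)), as a natural number.
    doubleCutValue : ℕ
    doubleCutValue = sumℕ (λ e → if inCut G S e then doubleValue (does (inCover? e)) else 0)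

    doubleCutValue-split : doubleCutValue ≡ coverCut + (otherCut + otherCut)
    doubleCutValue-split = begin
      sumℕ (λ e → if c e then doubleValue (b e) else 0)
        ≡⟨ sumℕ≡sum (λ e → if c e then doubleValue (b e) else 0) ⟩
      sum (λ e → if c e then doubleValue (b e) else 0)
        ≡⟨ sum-cong-≗ (λ e → doubleValue-split (c e) (b e)) ⟩
      sum (λ e → ind (c e ∧ b e) + (other e + other e))
        ≡⟨ ∑-distrib-+ (λ e → ind (c e ∧ b e)) (λ e → other e + other e) ⟩
      coverCut + sum (λ e → other e + other e)
        ≡⟨ cong (coverCut +_) (∑-distrib-+ other other) ⟩
      coverCut + (otherCut + otherCut) ∎
      where
      c b : Fin (m G) → Bool
      c e = inCut G S e
      b e = does (inCover? e)
      other : Fin (m G) → ℕ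
      other e = ind (c e ∧ not (b e))

    doubleCutValue≥4 : EdgeConnected 3 G → NonTrivial S → 4 ≤ doubleCutValue
    doubleCutValue≥4 connected nontrivial =
      ℕₚ.≤-trans (even-cut-bound coverCut otherCut three≤cut coverCut-even)
                 (ℕₚ.≤-reflexive (sym doubleCutValue-split))
      where
      three≤cut : 3 ≤ coverCut + otherCut
      three≤cut = ℕₚ.≤-trans (connected S nontrivial) (ℕₚ.≤-reflexive cutSize-split)

sumℚ-multiples : ∀ {k} (f : Fin k → ℚ) (g : Fin k → ℕ) (q : ℚ) →
                 (∀ i → f i ≡ g i ×ℚ q) → sumℚ f ≡ sumℕ g ×ℚ q
sumℚ-multiples {zero}  f g q f≡gq = refl
sumℚ-multiples {suc k} f g q f≡gq = begin
  f Fin.zero ℚ.+ sumℚ (λ i → f (Fin.suc i))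
    ≡⟨ cong₂ ℚ._+_ (f≡gq Fin.zero)
                   (sumℚ-multiples (λ i → f (Fin.suc i)) (λ i → g (Fin.suc i)) q
                                   (λ i → f≡gq (Fin.suc i))) ⟩
  g Fin.zero ×ℚ q ℚ.+ sumℕ (λ i → g (Fin.suc i)) ×ℚ q
    ≡⟨ sym (×-homo-+ q (g Fin.zero) _) ⟩
  sumℕ g ×ℚ q ∎

×ℚ-nonneg : ∀ k {q} → ℚ.0ℚ ℚ.≤ q → ℚ.0ℚ ℚ.≤ k ×ℚ q
×ℚ-nonneg zero    0≤q = ℚₚ.≤-refl
×ℚ-nonneg (suc k) 0≤q = ℚₚ.+-mono-≤ 0≤q (×ℚ-nonneg k 0≤q)

two≤halves : ∀ {k} → 4 ≤ k → 1ℚ ℚ.+ 1ℚ ℚ.≤ k ×ℚ ½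
two≤halves {k} 4≤k with ℕₚ.m≤n⇒∃[o]m+o≡n 4≤k
... | j , refl =
  -- 2 = 2 + 0 ≤ 4·½ + j·½ = (4 + j)·½
  ℚₚ.≤-trans (ℚₚ.≤-reflexive (sym (ℚₚ.+-identityʳ (1ℚ ℚ.+ 1ℚ))))
    (ℚₚ.≤-trans (ℚₚ.+-monoʳ-≤ (1ℚ ℚ.+ 1ℚ) (×ℚ-nonneg j (from-yes (ℚ.0ℚ ℚ.≤? ½))))
                (ℚₚ.≤-reflexive (sym (×-homo-+ ½ 4 j))))

halfDoubleValue-bounds : ∀ b →
  (ℚ.0ℚ ℚ.≤ doubleValue b ×ℚ ½) × (doubleValue b ×ℚ ½ ℚ.≤ 1ℚ ℚ.+ 1ℚ)
halfDoubleValue-bounds true  = from-yes (ℚ.0ℚ ℚ.≤? ½) , from-yes (½ ℚ.≤? 1ℚ ℚ.+ 1ℚ)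
halfDoubleValue-bounds false = from-yes (ℚ.0ℚ ℚ.≤? 1ℚ) , from-yes (1ℚ ℚ.≤? 1ℚ ℚ.+ 1ℚ)

lemma4 : (G : Graph) → Cubic G → EdgeConnected 3 G → (C : CycleCover G) →
         (x : Fin (m G) → ℚ) →
         (∀ e → e ∈E C → x e ≡ ½) → (∀ e → ¬ (e ∈E C) → x e ≡ 1ℚ) →
         InLP G x
lemma4 G _ connected C x on-cover off-cover = cut-constraint , lower , upper
  where
  x≡half : ∀ e → x e ≡ doubleValue (does (inCover? C e)) ×ℚ ½
  x≡half e with inCover? C e
  ... | yes e∈C = on-cover e e∈C
  ... | no  e∉C = off-cover e e∉C

  cut-constraint : ∀ S → NonTrivial S →
                   1ℚ ℚ.+ 1ℚ ℚ.≤ sumℚ (λ e → if inCut G S e then x e else ℚ.0ℚ)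
  cut-constraint S nontrivial =
    ℚₚ.≤-trans (two≤halves (doubleCutValue≥4 C S connected nontrivial))
               (ℚₚ.≤-reflexive (sym (sumℚ-multiples _ _ ½ summand)))
    where
    summand : ∀ e → (if inCut G S e then x e else ℚ.0ℚ) ≡
                    (if inCut G S e then doubleValue (does (inCover? C e)) else 0) ×ℚ ½
    summand e with inCut G S e
    ... | true  = x≡half e
    ... | false = refl

  lower : ∀ e → ℚ.0ℚ ℚ.≤ x e
  lower e rewrite x≡half e = proj₁ (halfDoubleValue-bounds (does (inCover? C e)))

  upper : ∀ e → x e ℚ.≤ 1ℚ ℚ.+ 1ℚ
  upper e rewrite x≡half e = proj₂ (halfDoubleValue-bounds (does (inCover? C e)))
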